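{- Let $G$ be a finite simple graph which is a $d$-manifold and let $e=(a,b)$ be an edge of $G$. Let $G_e$ be the edge refinement of $G$ at $e$: add a new vertex $v$, remove the edge $(a,b)$, and join $v$ to $a$, to $b$, and to every vertex of $S(a)\cap S(b)$. Then $G_e$ is again a $d$-manifold.
   Context: For a finite simple graph $G$ and a vertex $v$, the unit sphere $S(v)$ is the subgraph induced by the neighbours of $v$; $S(a)\cap S(b)$ is the subgraph induced by the common neighbours of $a$ and $b$. Inductive definitions: the empty graph is the $(-1)$-sphere; the one-vertex graph $K_1$ is contractible; a graph $G$ is contractible if there is a vertex $v$ such that both $S(v)$ and $G-v$ (the induced subgraph on the remaining vertices) are contractible; $G$ is a $d$-manifold if every unit sphere $S(v)$ is a $(d-1)$-sphere; $G$ is a $d$-sphere if it is a $d$-manifold and there is a vertex $v$ with $G-v$ contractible. -}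

module Defs where

open import Data.Nat using (ℕ; zero; suc)
open import Data.Fin using (Fin; zero; suc; _≟_)
open import Data.Bool using (Bool; true; false; _∧_; _∨_; not)
open import Data.Bool.Properties using (∨-comm)
open import Data.List using (List; []; _∷_; length; lookup; allFin)
open import Data.Product using (Σ; _×_; _,_)
open import Relation.Nullary using (does)
open import Relation.Binary.PropositionalEquality using (_≡_; refl; cong₂)

_==_ : ∀ {n} → Fin n → Fin n → Bool
x == y = does (x ≟ y)

record Graph : Set where
  field
    n      : ℕ
    adj    : Fin n → Fin n → Bool
    sym    : ∀ i j → adj i j ≡ adj j i
    irrefl : ∀ i → adj i i ≡ false
open Graph public

select : ∀ {n} → (Fin n → Bool) → List (Fin n) → List (Fin n)
select P [] = []
select P (x ∷ xs) with P x
... | true  = x ∷ select P xs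
... | false = select P xs

induced : (G : Graph) → (Fin (n G) → Bool) → Graph
induced G P = record
  { n      = length l
  ; adj    = λ i j → adj G (lookup l i) (lookup l j)
  ; sym    = λ i j → sym G (lookup l i) (lookup l j)
  ; irrefl = λ i → irrefl G (lookup l i)
  }
  where l = select P (allFin (n G))

S : (G : Graph) → Fin (n G) → Graph
S G v = induced G (adj G v)

_─_ : (G : Graph) → Fin (n G) → Graph
G ─ v = induced G (λ x → not (x == v))

data Contractible : Graph → Set where
  K₁   : ∀ G → n G ≡ 1 → Contractible G
  step : ∀ G (v : Fin (n G)) → Contractible (S G v) → Contractible (G ─ v)
       → Contractible G

-- Sphere k G  means  "G is a (k-1)-sphere"  (index shifted by one so the
-- (-1)-sphere is Sphere 0):
--   (-1)-sphere: the empty graph;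
--   d-sphere (d ≥ 0): a d-manifold (every unit sphere a (d-1)-sphere)
--   with some vertex v such that G - v is contractible.
Sphere : ℕ → Graph → Set
Sphere zero    G = n G ≡ 0
Sphere (suc k) G = (∀ v → Sphere k (S G v)) × Σ (Fin (n G)) (λ v → Contractible (G ─ v))

Manifold : ℕ → Graph → Set
Manifold d G = ∀ v → Sphere d (S G v)

-- Edge refinement of G at the edge (a,b): new vertex (index zero; old
-- vertex x becomes suc x), edge (a,b) removed, new vertex joined to a, b
-- and every vertex of S(a) ∩ S(b).
module _ (G : Graph) (a b : Fin (n G)) where
  private
    isAB : Fin (n G) → Fin (n G) → Bool
    isAB x y = (x == a ∧ y == b) ∨ (x == b ∧ y == a)

    nb : Fin (n G) → Bool
    nb x = x == a ∨ x == b ∨ (adj G a x ∧ adj G b x)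

    isAB-sym : ∀ x y → isAB x y ≡ isAB y x
    isAB-sym x y = ∨-comm (x == a ∧ y == b) (x == b ∧ y == a) ⟨trans⟩ swap
      where
        open import Data.Bool.Properties using (∧-comm)
        open import Relation.Binary.PropositionalEquality using (trans)
        _⟨trans⟩_ = trans
        swap : (x == b ∧ y == a) ∨ (x == a ∧ y == b) ≡ isAB y x
        swap = cong₂ _∨_ (∧-comm (x == b) (y == a)) (∧-comm (x == a) (y == b))

    adjE : Fin (suc (n G)) → Fin (suc (n G)) → Bool
    adjE zero    zero    = false
    adjE zero    (suc y) = nb y
    adjE (suc x) zero    = nb x
    adjE (suc x) (suc y) = adj G x y ∧ not (isAB x y)

    symE : ∀ i j → adjE i j ≡ adjE j i
    symE zero    zero    = refl
    symE zero    (suc y) = refl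
    symE (suc x) zero    = refl
    symE (suc x) (suc y) = cong₂ (λ p q → p ∧ not q) (sym G x y) (isAB-sym x y)

    irreflE : ∀ i → adjE i i ≡ false
    irreflE zero    = refl
    irreflE (suc x) rewrite irrefl G x = refl

  edgeRefinement : Graph
  edgeRefinement = record { n = suc (n G) ; adj = adjE ; sym = symE ; irrefl = irreflE }

-- Write v for the new vertex of G_e. Its unit sphere is the suspension of S(a) ∩ S(b) with poles a
-- and b, and S(a) ∩ S(b) is a unit sphere of the (d-1)-sphere S(a), hence a (d-2)-sphere. The unit
-- sphere of a (or b) is S(a) (or S(b)) with the other endpoint renamed v; that of a common neighbour y
-- of a and b is the edge refinement of S(y) at (a,b); every other unit sphere is unchanged. So
-- G_e is a d-manifold once edge refinement is known to preserve (d-1)-spheres, which follows by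
-- induction on d together with the same statement for contractible graphs: deleting a vertex w ≠ a, b
-- of G_e gives the edge refinement of G - w, while G_e - a is G - a with v attached along the cone
-- from b over S(a) ∩ S(b), and attaching a vertex along a contractible graph preserves contractibility.

module Submission where

open import Defs renaming (sym to adj-sym)
open import Data.Nat using (ℕ; zero; suc; _≤_; _<_; s≤s)
open import Data.Nat.Properties using (≤-antisym; ≤-refl; ≤-trans; ≤-pred)
open import Data.Fin using (Fin; zero; suc; _≟_; lift; _↑ˡ_)
open import Data.Fin.Properties using (suc-injective; injective⇒≤)
open import Data.Bool using (Bool; true; false; _∧_; _∨_; not; T; T?)
import Data.Bool as Bool
open import Data.Bool.Properties
  using (¬-not; T-≡; ∨-comm; ∧-comm; ∧-identityʳ; ∧-zeroʳ; ∨-zeroʳ; ∧-conicalˡ; ∧-conicalʳ)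
open import Data.List using (List; lookup; allFin; filterᵇ; length)
import Data.List as List
open import Data.List.Properties using (filter-notAll; length-tabulate)
open import Data.List.Membership.Propositional using (_∈_; lose)
open import Data.List.Membership.Propositional.Properties
  using (∈-allFin; ∈-lookup; ∈-filter⁺; ∈-filter⁻)
open import Data.List.Relation.Unary.Any using (index)
open import Data.List.Relation.Unary.Any.Properties using (lookup-index)
import Data.List.Relation.Unary.All as All
open import Data.List.Relation.Unary.AllPairs using (_∷_)
open import Data.List.Relation.Unary.Unique.Propositional using (Unique)
open import Data.List.Relation.Unary.Unique.Propositional.Properties using (allFin⁺; filter⁺)
open import Data.Product using (Σ-syntax; _×_; _,_; proj₁; proj₂)
open import Data.Sum using (_⊎_; inj₁; inj₂)
open import Function using (_∘_; const; id; Equivalence)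
open import Data.Vec.Functional using () renaming (_∷_ to _∷ᶠ_)
open import Relation.Nullary using (¬_; yes; no; contradiction)
open import Relation.Nullary.Decidable using (dec-true; dec-false)
open import Relation.Binary.PropositionalEquality

private
  variable
    k m : ℕ

==-refl : (x : Fin m) → (x == x) ≡ true
==-refl x = dec-true (x ≟ x) refl

≢⇒==false : {x y : Fin m} → x ≢ y → (x == y) ≡ false
≢⇒==false {x = x} {y} = dec-false (x ≟ y)

not==⇒≢ : {x y : Fin m} → not (x == y) ≡ true → x ≢ y
not==⇒≢ {x = x} e refl = contradiction (trans (sym e) (cong not (==-refl x))) λ ()

adj⇒≢ : (G : Graph) {x y : Fin (n G)} → adj G x y ≡ true → x ≢ y
adj⇒≢ G {x} e refl = contradiction (trans (sym e) (irrefl G x)) λ ()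

Fin1-unique : ∀ {k} → k ≡ 1 → (x y : Fin k) → x ≡ y
Fin1-unique refl zero zero = refl

==∧==-false : {x y u v : Fin m} → ¬ (x ≡ u × y ≡ v) → (x == u ∧ y == v) ≡ false
==∧==-false {x = x} {y} {u} {v} ¬xy with x ≟ u | y ≟ v
... | yes refl | yes refl = contradiction (refl , refl) ¬xy
... | yes _    | no _     = refl
... | no _     | _        = refl

select≡filterᵇ : (P : Fin m → Bool) (xs : List (Fin m)) → select P xs ≡ filterᵇ P xs
select≡filterᵇ P List.[] = refl
select≡filterᵇ P (x List.∷ xs) with P x
... | true  = cong (x List.∷_) (select≡filterᵇ P xs)
... | false = select≡filterᵇ P xs

module _ (P : Fin m → Bool) (xs : List (Fin m)) where

  ∈-select⁻ : ∀ {x} → x ∈ select P xs → P x ≡ true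
  ∈-select⁻ x∈ =
    Equivalence.to T-≡ (proj₂ (∈-filter⁻ (T? ∘ P) {xs = xs} (subst (_ ∈_) (select≡filterᵇ P xs) x∈)))

  ∈-select⁺ : ∀ {x} → x ∈ xs → P x ≡ true → x ∈ select P xs
  ∈-select⁺ x∈ Px =
    subst (_ ∈_) (sym (select≡filterᵇ P xs)) (∈-filter⁺ (T? ∘ P) x∈ (Equivalence.from T-≡ Px))

  select-unique : Unique xs → Unique (select P xs)
  select-unique u = subst Unique (sym (select≡filterᵇ P xs)) (filter⁺ (T? ∘ P) u)

  length-select< : ∀ {x} → x ∈ xs → P x ≡ false → length (select P xs) < length xs
  length-select< x∈ Px rewrite select≡filterᵇ P xs =
    filter-notAll (T? ∘ P) xs (lose x∈ (λ T[Px] → subst T Px T[Px]))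

lookup-injective : {xs : List (Fin m)} → Unique xs → ∀ {i j} → lookup xs i ≡ lookup xs j → i ≡ j
lookup-injective (_ ∷ _) {zero} {zero} _ = refl
lookup-injective (x∉ ∷ _) {zero} {suc j} e = contradiction e (All.lookup x∉ (∈-lookup j))
lookup-injective (x∉ ∷ _) {suc i} {zero} e = contradiction (sym e) (All.lookup x∉ (∈-lookup i))
lookup-injective (_ ∷ u) {suc i} {suc j} e = cong suc (lookup-injective u e)

-- Isomorphisms between induced subgraphs

record BijOn (P : Fin m → Bool) (f : Fin m → Fin k) (Q : Fin k → Bool) : Set where
  field
    injective : ∀ {x y} → P x ≡ true → P y ≡ true → f x ≡ f y → x ≡ y
    maps      : ∀ {x} → P x ≡ true → Q (f x) ≡ true
    onto      : ∀ {y} → Q y ≡ true → Σ[ x ∈ Fin m ] P x ≡ true × f x ≡ y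

module _ {P : Fin m → Bool} {Q : Fin k → Bool} {f : Fin m → Fin k} where

  BijOn-∘ : ∀ {j} {R : Fin j → Bool} {g : Fin k → Fin j} → BijOn Q g R → BijOn P f Q → BijOn P (g ∘ f) R
  BijOn-∘ {g = g} βg βf = record
    { injective = λ Px Py e → injective βf Px Py (injective βg (maps βf Px) (maps βf Py) e)
    ; maps      = maps βg ∘ maps βf
    ; onto      = λ Rz → let (y , Qy , gy) = onto βg Rz ; (x , Px , fx) = onto βf Qy
                         in x , Px , trans (cong g fx) gy
    }
    where open BijOn

  BijOn-restrict : {P′ : Fin m → Bool} {Q′ : Fin k → Bool} → BijOn P f Q
                 → (∀ {x} → P′ x ≡ true → P x ≡ true) → (∀ {y} → Q′ y ≡ true → Q y ≡ true)
                 → (∀ {x} → P x ≡ true → Q′ (f x) ≡ P′ x) → BijOn P′ f Q′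
  BijOn-restrict {Q′ = Q′} β P′⊆P Q′⊆Q Q′∘f = record
    { injective = λ Px Py → injective β (P′⊆P Px) (P′⊆P Py)
    ; maps      = λ P′x → trans (Q′∘f (P′⊆P P′x)) P′x
    ; onto      = λ {y} Q′y → let (x , Px , fx) = onto β (Q′⊆Q Q′y)
                              in x , trans (sym (Q′∘f Px)) (trans (cong Q′ fx) Q′y) , fx
    }
    where open BijOn

BijOn-lift : {Q : Fin k → Bool} {Q′ : Fin (suc k) → Bool} {f : Fin m → Fin k}
           → BijOn (const true) f Q → Q′ zero ≡ true → (∀ y → Q′ (suc y) ≡ Q y)
           → BijOn (const true) (lift 1 f) Q′
BijOn-lift {Q′ = Q′} {f} β Q′₀ Q′ₛ = record
  { injective = λ {x} {y} _ _ → inj x y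
  ; maps      = λ {x} _ → mp x
  ; onto      = on
  }
  where
  open BijOn β
  inj : ∀ x y → lift 1 f x ≡ lift 1 f y → x ≡ y
  inj zero    zero    _ = refl
  inj (suc x) (suc y) e = cong suc (injective refl refl (suc-injective e))
  mp : ∀ x → Q′ (lift 1 f x) ≡ true
  mp zero    = Q′₀
  mp (suc x) = trans (Q′ₛ (f x)) (maps refl)
  on : ∀ {y} → Q′ y ≡ true → Σ[ x ∈ _ ] true ≡ true × lift 1 f x ≡ y
  on {zero}  _   = zero , refl , refl
  on {suc y} Q′y = let (x , _ , fx) = onto (trans (sym (Q′ₛ y)) Q′y) in suc x , refl , cong suc fx

BijOn-suc : {P : Fin m → Bool} (Q : Fin (suc m) → Bool) → Q zero ≡ false → (∀ x → Q (suc x) ≡ P x)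
          → BijOn P suc Q
BijOn-suc {P = P} Q Q₀ Qₛ = record
  { injective = λ _ _ → suc-injective
  ; maps      = λ {x} Px → trans (Qₛ x) Px
  ; onto      = on
  }
  where
  on : ∀ {y} → Q y ≡ true → Σ[ x ∈ Fin _ ] P x ≡ true × suc x ≡ y
  on {zero}  Q₀′ = contradiction (trans (sym Q₀) Q₀′) λ ()
  on {suc x} Qx  = x , trans (sym (Qₛ x)) Qx , refl

record IsoOn (G : Graph) (P : Fin (n G) → Bool) (H : Graph) (Q : Fin (n H) → Bool)
             (f : Fin (n G) → Fin (n H)) : Set where
  field
    bijOn     : BijOn P f Q
    preserves : ∀ {x y} → P x ≡ true → P y ≡ true → adj H (f x) (f y) ≡ adj G x y
  open BijOn bijOn public
open IsoOn

IsoOnto : (G H : Graph) → (Fin (n H) → Bool) → (Fin (n G) → Fin (n H)) → Set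
IsoOnto G = IsoOn G (const true)

infix 4 _≅_
_≅_ : Graph → Graph → Set
G ≅ H = Σ[ f ∈ (Fin (n G) → Fin (n H)) ] IsoOnto G H (const true) f

module _ {G H : Graph} {P : Fin (n G) → Bool} {Q : Fin (n H) → Bool} {f : Fin (n G) → Fin (n H)} where

  IsoOn-∘ : ∀ {K} {R : Fin (n K) → Bool} {g : Fin (n H) → Fin (n K)}
          → IsoOn H Q K R g → IsoOn G P H Q f → IsoOn G P K R (g ∘ f)
  IsoOn-∘ ιg ιf = record
    { bijOn     = BijOn-∘ (bijOn ιg) (bijOn ιf)
    ; preserves = λ Px Py → trans (preserves ιg (maps ιf Px) (maps ιf Py)) (preserves ιf Px Py)
    }

  IsoOn-restrict : {P′ : Fin (n G) → Bool} {Q′ : Fin (n H) → Bool} → IsoOn G P H Q f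
                 → (∀ {x} → P′ x ≡ true → P x ≡ true) → (∀ {y} → Q′ y ≡ true → Q y ≡ true)
                 → (∀ {x} → P x ≡ true → Q′ (f x) ≡ P′ x) → IsoOn G P′ H Q′ f
  IsoOn-restrict ι P′⊆P Q′⊆Q Q′∘f = record
    { bijOn     = BijOn-restrict (bijOn ι) P′⊆P Q′⊆Q Q′∘f
    ; preserves = λ Px Py → preserves ι (P′⊆P Px) (P′⊆P Py)
    }

  IsoOn-== : IsoOn G P H Q f → ∀ {x y} → P x ≡ true → P y ≡ true → (f x == f y) ≡ (x == y)
  IsoOn-== ι {x} {y} Px Py with x ≟ y
  ... | yes refl = ==-refl (f x)
  ... | no x≢y   = ≢⇒==false (x≢y ∘ injective ι Px Py)

module _ {G H : Graph} {f : Fin (n G) → Fin (n H)} (ι : IsoOnto G H (const true) f) where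

  IsoOn-S : ∀ v → IsoOn G (adj G v) H (adj H (f v)) f
  IsoOn-S v = IsoOn-restrict ι (λ _ → refl) (λ _ → refl) (λ _ → preserves ι refl refl)

  IsoOn-─ : ∀ v → IsoOn G (λ x → not (x == v)) H (λ y → not (y == f v)) f
  IsoOn-─ v = IsoOn-restrict ι (λ _ → refl) (λ _ → refl) (λ _ → cong not (IsoOn-== ι refl refl))

sameImage⇒≅ : ∀ {G H K R f g} → IsoOnto G K R f → IsoOnto H K R g → G ≅ H
sameImage⇒≅ {G} {H} {K} {R} {f} {g} ιf ιg = to , record
  { bijOn     = record
    { injective = λ _ _ e →
        injective ιf refl refl (trans (sym (to-correct _)) (trans (cong g e) (to-correct _)))
    ; maps      = λ _ → refl
    ; onto      = onto-to
    }
  ; preserves = λ {x} {y} _ _ →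
      trans (sym (preserves ιg refl refl))
            (trans (cong₂ (adj K) (to-correct x) (to-correct y)) (preserves ιf refl refl))
  }
  where
  preimage : ∀ x → Σ[ y ∈ Fin (n H) ] true ≡ true × g y ≡ f x
  preimage x = onto ιg (maps ιf refl)
  to : Fin (n G) → Fin (n H)
  to x = proj₁ (preimage x)
  to-correct : ∀ x → g (to x) ≡ f x
  to-correct x = proj₂ (proj₂ (preimage x))
  onto-to : ∀ {y} → true ≡ true → Σ[ x ∈ Fin (n G) ] true ≡ true × to x ≡ y
  onto-to {y} _ = let (x , _ , fx) = onto ιf (maps ιg refl)
                  in x , refl , injective ιg refl refl (trans (to-correct x) fx)

incl : (G : Graph) (P : Fin (n G) → Bool) → Fin (n (induced G P)) → Fin (n G)
incl G P = lookup (select P (allFin (n G)))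

incl-IsoOn : (G : Graph) (P : Fin (n G) → Bool) → IsoOnto (induced G P) G P (incl G P)
incl-IsoOn G P = record
  { bijOn     = record
    { injective = λ _ _ → lookup-injective (select-unique P (allFin (n G)) (allFin⁺ (n G)))
    ; maps      = λ {i} _ → ∈-select⁻ P (allFin (n G)) (∈-lookup i)
    ; onto      = λ {x} Px → let x∈ = ∈-select⁺ P (allFin (n G)) (∈-allFin x) Px
                             in index x∈ , refl , sym (lookup-index x∈)
    }
  ; preserves = λ _ _ → refl
  }

induced-smaller : (G : Graph) (P : Fin (n G) → Bool) {x : Fin (n G)} → P x ≡ false → n (induced G P) < n G
induced-smaller G P {x} Px = subst (n (induced G P) <_) (length-tabulate id)
  (length-select< P (allFin (n G)) (∈-allFin x) Px)

IsoOnto⇒≅induced : ∀ {G H Q f} → IsoOnto G H Q f → G ≅ induced H Q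
IsoOnto⇒≅induced {H = H} {Q} ι = sameImage⇒≅ ι (incl-IsoOn H Q)

IsoOn⇒induced≅ : ∀ {G P H Q f} → IsoOn G P H Q f → induced G P ≅ induced H Q
IsoOn⇒induced≅ {G} {P} ι = IsoOnto⇒≅induced (IsoOn-∘ ι (incl-IsoOn G P))

n-≅ : ∀ {G H} → G ≅ H → n G ≡ n H
n-≅ {G} {H} (f , ι) = ≤-antisym (injective⇒≤ (injective ι refl refl)) (injective⇒≤ inverse-injective)
  where
  inverse : Fin (n H) → Fin (n G)
  inverse y = proj₁ (onto ι {y} refl)
  f∘inverse : ∀ y → f (inverse y) ≡ y
  f∘inverse y = proj₂ (proj₂ (onto ι {y} refl))
  inverse-injective : ∀ {y y′} → inverse y ≡ inverse y′ → y ≡ y′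
  inverse-injective {y} {y′} e = trans (sym (f∘inverse y)) (trans (cong f e) (f∘inverse y′))

S-≅ : ∀ {G H} (σ : G ≅ H) v → S G v ≅ S H (proj₁ σ v)
S-≅ (_ , ι) v = IsoOn⇒induced≅ (IsoOn-S ι v)

─-≅ : ∀ {G H} (σ : G ≅ H) v → G ─ v ≅ H ─ proj₁ σ v
─-≅ (_ , ι) v = IsoOn⇒induced≅ (IsoOn-─ ι v)

Contractible-resp-≅ : ∀ {G H} → G ≅ H → Contractible G → Contractible H
Contractible-resp-≅ {H = H} σ (K₁ _ one)        = K₁ H (trans (sym (n-≅ σ)) one)
Contractible-resp-≅ {H = H} σ (step _ v cS c─) =
  step H (proj₁ σ v) (Contractible-resp-≅ (S-≅ σ v) cS) (Contractible-resp-≅ (─-≅ σ v) c─)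

Sphere-resp-≅ : ∀ k {G H} → G ≅ H → Sphere k G → Sphere k H
Sphere-resp-≅ zero    σ empty          = trans (sym (n-≅ σ)) empty
Sphere-resp-≅ (suc k) {H = H} σ@(f , ι) (spheres , v , c) =
  unitSpheres , f v , Contractible-resp-≅ (─-≅ σ v) c
  where
  unitSpheres : ∀ w → Sphere k (S H w)
  unitSpheres w with onto ι {w} refl
  ... | u , _ , refl = Sphere-resp-≅ k (S-≅ σ u) (spheres u)

-- Attaching a vertex; cones and suspensions

Attach : (X : Graph) → (Fin (n X) → Bool) → Graph
Attach X N = record { n = suc (n X) ; adj = adjᴬ ; sym = symᴬ ; irrefl = irreflᴬ }
  where
  adjᴬ : Fin (suc (n X)) → Fin (suc (n X)) → Bool
  adjᴬ zero    zero    = false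
  adjᴬ zero    (suc y) = N y
  adjᴬ (suc x) zero    = N x
  adjᴬ (suc x) (suc y) = adj X x y
  symᴬ : ∀ x y → adjᴬ x y ≡ adjᴬ y x
  symᴬ zero    zero    = refl
  symᴬ zero    (suc y) = refl
  symᴬ (suc x) zero    = refl
  symᴬ (suc x) (suc y) = adj-sym X x y
  irreflᴬ : ∀ x → adjᴬ x x ≡ false
  irreflᴬ zero    = refl
  irreflᴬ (suc x) = irrefl X x

module _ {X : Graph} {N : Fin (n X) → Bool} where

  suc-IsoOn : {P : Fin (n X) → Bool} (Q : Fin (suc (n X)) → Bool)
            → Q zero ≡ false → (∀ x → Q (suc x) ≡ P x)
            → IsoOn X P (Attach X N) Q suc
  suc-IsoOn Q Q₀ Qₛ = record { bijOn = BijOn-suc Q Q₀ Qₛ ; preserves = λ _ _ → refl }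

  Attach-S₀ : induced X N ≅ S (Attach X N) zero
  Attach-S₀ = IsoOn⇒induced≅ (suc-IsoOn (adj (Attach X N) zero) refl λ _ → refl)

  Attach-─₀ : X ≅ Attach X N ─ zero
  Attach-─₀ = IsoOnto⇒≅induced (suc-IsoOn (λ y → not (y == zero)) refl λ _ → refl)

  Attach-contractible : Contractible X → Contractible (induced X N) → Contractible (Attach X N)
  Attach-contractible cX cN =
    step _ zero (Contractible-resp-≅ Attach-S₀ cN) (Contractible-resp-≅ Attach-─₀ cX)

Attach-IsoOn : ∀ {X Y Q f} N M (Q′ : Fin (suc (n Y)) → Bool)
             → IsoOnto X Y Q f → (∀ x → M (f x) ≡ N x)
             → Q′ zero ≡ true → (∀ y → Q′ (suc y) ≡ Q y)
             → IsoOnto (Attach X N) (Attach Y M) Q′ (lift 1 f)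
Attach-IsoOn {X} {Y} {f = f} N M Q′ ι M∘f Q′₀ Q′ₛ = record
  { bijOn     = BijOn-lift (bijOn ι) Q′₀ Q′ₛ
  ; preserves = λ {x} {y} _ _ → pres x y
  }
  where
  pres : ∀ x y → adj (Attach Y M) (lift 1 f x) (lift 1 f y) ≡ adj (Attach X N) x y
  pres zero    zero    = refl
  pres zero    (suc y) = M∘f y
  pres (suc x) zero    = M∘f x
  pres (suc x) (suc y) = preserves ι refl refl

Attach-IsoOn-apex : ∀ {X Y R g} N (Q : Fin (n Y) → Bool)
                  → IsoOnto X Y R g → (p : Fin (n Y)) → R p ≡ false
                  → (∀ x → adj Y p (g x) ≡ N x) → Q p ≡ true → (∀ {y} → y ≢ p → Q y ≡ R y)
                  → IsoOnto (Attach X N) Y Q (p ∷ᶠ g)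
Attach-IsoOn-apex {X} {Y} {R} {g} N Q ι p Rp adj-p Qp Q≗R = record
  { bijOn     = record
    { injective = λ {x} {y} _ _ → inj x y
    ; maps      = λ {x} _ → mp x
    ; onto      = on
    }
  ; preserves = λ {x} {y} _ _ → pres x y
  }
  where
  g≢p : ∀ x → g x ≢ p
  g≢p x e = contradiction (trans (sym (maps ι {x} refl)) (trans (cong R e) Rp)) λ ()
  inj : ∀ x y → (p ∷ᶠ g) x ≡ (p ∷ᶠ g) y → x ≡ y
  inj zero    zero    _ = refl
  inj zero    (suc y) e = contradiction (sym e) (g≢p y)
  inj (suc x) zero    e = contradiction e (g≢p x)
  inj (suc x) (suc y) e = cong suc (injective ι refl refl e)
  mp : ∀ x → Q ((p ∷ᶠ g) x) ≡ true
  mp zero    = Qp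
  mp (suc x) = trans (Q≗R (g≢p x)) (maps ι refl)
  on : ∀ {y} → Q y ≡ true → Σ[ x ∈ Fin (suc (n X)) ] true ≡ true × (p ∷ᶠ g) x ≡ y
  on {y} Qy with y ≟ p
  ... | yes refl = zero , refl , refl
  ... | no y≢p   = let (x , _ , gx) = onto ι (trans (sym (Q≗R y≢p)) Qy) in suc x , refl , gx
  pres : ∀ x y → adj Y ((p ∷ᶠ g) x) ((p ∷ᶠ g) y) ≡ adj (Attach X N) x y
  pres zero    zero    = irrefl Y p
  pres zero    (suc y) = adj-p y
  pres (suc x) zero    = trans (adj-sym Y (g x) p) (adj-p x)
  pres (suc x) (suc y) = preserves ι refl refl

Cone : Graph → Graph
Cone X = Attach X (const true)

Cone-S-IsoOn : ∀ X x → IsoOnto (Cone (S X x)) (Cone X) (adj (Cone X) (suc x)) (lift 1 (incl X (adj X x)))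
Cone-S-IsoOn X x = Attach-IsoOn (const true) (const true) (adj (Cone X) (suc x))
                                (incl-IsoOn X (adj X x)) (λ _ → refl) refl (λ _ → refl)

Cone-S : ∀ X x → Cone (S X x) ≅ S (Cone X) (suc x)
Cone-S X x = IsoOnto⇒≅induced (Cone-S-IsoOn X x)

Cone-─ : ∀ X x → Cone (X ─ x) ≅ Cone X ─ suc x
Cone-─ X x = IsoOnto⇒≅induced
  (Attach-IsoOn (const true) (const true) (λ y → not (y == suc x)) (incl-IsoOn X (λ y → not (y == x)))
                (λ _ → refl) refl (λ _ → refl))

-- Not through the apex, whose unit sphere is X: remove a vertex x of X instead, by induction on n X.
Cone-contractible : ∀ X → Contractible (Cone X)
Cone-contractible X = bounded (n X) X ≤-refl
  where
  bounded : ∀ m X → n X ≤ m → Contractible (Cone X)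
  bounded m X n≤m with n X in n≡
  ... | zero = K₁ (Cone X) (cong suc n≡)
  bounded (suc m) X (s≤s n≤m) | suc _ =
    step (Cone X) (suc x)
      (Contractible-resp-≅ (Cone-S X x) (bounded m (S X x) (smaller (adj X x) (irrefl X x))))
      (Contractible-resp-≅ (Cone-─ X x) (bounded m (X ─ x) (smaller (λ y → not (y == x)) (cong not (==-refl x)))))
    where
    x : Fin (n X)
    x = subst Fin (sym n≡) zero
    smaller : ∀ P → P x ≡ false → n (induced X P) ≤ m
    smaller P Px = ≤-trans (≤-pred (subst (n (induced X P) <_) n≡ (induced-smaller X P Px))) n≤m

nonApex : Fin (suc m) → Bool
nonApex zero    = false
nonApex (suc _) = true

-- the two apices are zero and suc zero
Susp : Graph → Graph
Susp X = Attach (Cone X) nonApex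

Susp-pole : ∀ X (p : Fin 2) → X ≅ S (Susp X) (p ↑ˡ n X)
Susp-pole X p = IsoOnto⇒≅induced pole
  where
  pole-adj : ∀ p x → adj (Susp X) (p ↑ˡ n X) (suc (suc x)) ≡ true
  pole-adj zero       _ = refl
  pole-adj (suc zero) _ = refl
  on : ∀ p y → adj (Susp X) (p ↑ˡ n X) y ≡ true
     → Σ[ x ∈ Fin (n X) ] true ≡ true × suc (suc x) ≡ y
  on zero       (suc (suc x)) _ = x , refl , refl
  on (suc zero) (suc (suc x)) _ = x , refl , refl
  pole : IsoOnto X (Susp X) (adj (Susp X) (p ↑ˡ n X)) (λ x → suc (suc x))
  pole = record
    { bijOn     = record
      { injective = λ _ _ → suc-injective ∘ suc-injective
      ; maps      = λ {x} _ → pole-adj p x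
      ; onto      = λ {y} → on p y
      }
    ; preserves = λ _ _ → refl
    }

Susp-S : ∀ X x → Susp (S X x) ≅ S (Susp X) (suc (suc x))
Susp-S X x = IsoOnto⇒≅induced
  (Attach-IsoOn nonApex nonApex (adj (Susp X) (suc (suc x)))
    (Cone-S-IsoOn X x)
    nonApex∘lift refl (λ _ → refl))
  where
  nonApex∘lift : ∀ y → nonApex (lift 1 (incl X (adj X x)) y) ≡ nonApex y
  nonApex∘lift zero    = refl
  nonApex∘lift (suc _) = refl

Susp-sphere : ∀ k X → Sphere k X → Sphere (suc k) (Susp X)
Susp-sphere k X s = unitSpheres k s , zero , Contractible-resp-≅ Attach-─₀ (Cone-contractible X)
  where
  unitSpheres : ∀ k → Sphere k X → ∀ v → Sphere k (S (Susp X) v)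
  unitSpheres k       s zero          = Sphere-resp-≅ k (Susp-pole X zero) s
  unitSpheres k       s (suc zero)    = Sphere-resp-≅ k (Susp-pole X (suc zero)) s
  unitSpheres zero    s (suc (suc x)) = contradiction (subst Fin s x) λ ()
  unitSpheres (suc k) s (suc (suc x)) =
    Sphere-resp-≅ (suc k) (Susp-S X x) (Susp-sphere k (S X x) (proj₁ s x))

-- Edge refinement

record IsEdgeRefinementOf (K′ K : Graph) : Set where
  field
    {u v} : Fin (n K)
    edge  : adj K u v ≡ true
    iso   : edgeRefinement K u v ≅ K′

edgeRefinement-IsoOn : ∀ {X Y Q f} {a′ b′ : Fin (n X)} {a b : Fin (n Y)} (Q′ : Fin (suc (n Y)) → Bool)
                     → IsoOnto X Y Q f → f a′ ≡ a → f b′ ≡ b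
                     → Q′ zero ≡ true → (∀ y → Q′ (suc y) ≡ Q y)
                     → IsoOnto (edgeRefinement X a′ b′) (edgeRefinement Y a b) Q′ (lift 1 f)
edgeRefinement-IsoOn {X} {Y} {f = f} {a′} {b′} Q′ ι refl refl Q′₀ Q′ₛ = record
  { bijOn     = BijOn-lift (bijOn ι) Q′₀ Q′ₛ
  ; preserves = λ {x} {y} _ _ → pres x y
  }
  where
  ==-f : ∀ x y → (f x == f y) ≡ (x == y)
  ==-f x y = IsoOn-== ι refl refl
  adj-f : ∀ x y → adj Y (f x) (f y) ≡ adj X x y
  adj-f x y = preserves ι refl refl
  new-f : ∀ x → adj (edgeRefinement Y (f a′) (f b′)) zero (suc (f x))
              ≡ adj (edgeRefinement X a′ b′) zero (suc x)
  new-f x = cong₂ _∨_ (==-f x a′) (cong₂ _∨_ (==-f x b′) (cong₂ _∧_ (adj-f a′ x) (adj-f b′ x)))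
  pres : ∀ x y → adj (edgeRefinement Y (f a′) (f b′)) (lift 1 f x) (lift 1 f y)
               ≡ adj (edgeRefinement X a′ b′) x y
  pres zero    zero    = refl
  pres zero    (suc y) = new-f y
  pres (suc x) zero    = new-f x
  pres (suc x) (suc y) rewrite ==-f x a′ | ==-f y b′ | ==-f x b′ | ==-f y a′ | adj-f x y = refl

induced-refinement : ∀ H {a b} (P : Fin (n H) → Bool) (Q : Fin (suc (n H)) → Bool) → adj H a b ≡ true
                   → P a ≡ true → P b ≡ true → Q zero ≡ true → (∀ x → Q (suc x) ≡ P x)
                   → IsEdgeRefinementOf (induced (edgeRefinement H a b) Q) (induced H P)
induced-refinement H P Q ab Pa Pb Q₀ Qₛ = record
  { edge = trans (cong₂ (adj H) ia′ ib′) ab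
  ; iso  = IsoOnto⇒≅induced (edgeRefinement-IsoOn Q (incl-IsoOn H P) ia′ ib′ Q₀ Qₛ)
  }
  where
  ia′ = proj₂ (proj₂ (onto (incl-IsoOn H P) Pa))
  ib′ = proj₂ (proj₂ (onto (incl-IsoOn H P) Pb))

module EdgeRefinement (H : Graph) {a b : Fin (n H)} (ab : adj H a b ≡ true) where

  private
    E : Graph
    E = edgeRefinement H a b

    a≢b : a ≢ b
    a≢b = adj⇒≢ H ab

  common : Fin (n H) → Bool
  common x = adj H a x ∧ adj H b x

  adjᴱ-old : ∀ {x y} → ¬ (x ≡ a × y ≡ b) → ¬ (x ≡ b × y ≡ a) → adj E (suc x) (suc y) ≡ adj H x y
  adjᴱ-old {x} {y} ¬ab ¬ba rewrite ==∧==-false ¬ab | ==∧==-false ¬ba = ∧-identityʳ (adj H x y)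

  adjᴱ-removed : adj E (suc a) (suc b) ≡ false
  adjᴱ-removed rewrite ==-refl a | ==-refl b = ∧-zeroʳ (adj H a b)

  adjᴱ-new : ∀ {x} → x ≢ a → x ≢ b → adj E zero (suc x) ≡ common x
  adjᴱ-new x≢a x≢b rewrite ≢⇒==false x≢a | ≢⇒==false x≢b = refl

  private
    suc-IsoOnᴱ : {P : Fin (n H) → Bool} (Q : Fin (suc (n H)) → Bool)
               → Q zero ≡ false → (∀ x → Q (suc x) ≡ P x)
               → (∀ {x y} → P x ≡ true → P y ≡ true → ¬ (x ≡ a × y ≡ b)) → IsoOn H P E Q suc
    suc-IsoOnᴱ Q Q₀ Qₛ avoids-ab = record
      { bijOn     = BijOn-suc Q Q₀ Qₛ
      ; preserves = λ Px Py →
          adjᴱ-old (avoids-ab Px Py) (λ (x≡b , y≡a) → avoids-ab Py Px (y≡a , x≡b))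
      }

  away-IsoOn : ∀ {y} → y ≢ a → y ≢ b → common y ≡ false → IsoOn H (adj H y) E (adj E (suc y)) suc
  away-IsoOn {y} y≢a y≢b not-common = suc-IsoOnᴱ (adj E (suc y)) (trans (adjᴱ-new y≢a y≢b) not-common)
    (λ _ → adjᴱ-old (y≢a ∘ proj₁) (y≢b ∘ proj₁)) not-both
    where
    not-both : ∀ {x x′} → adj H y x ≡ true → adj H y x′ ≡ true → ¬ (x ≡ a × x′ ≡ b)
    not-both ya yb (refl , refl) =
      contradiction (trans (sym not-common) (cong₂ _∧_ (trans (adj-sym H a y) ya) (trans (adj-sym H b y) yb)))
                    λ ()

  b↦new : Fin (n H) → Fin (suc (n H))
  b↦new x with x ≟ b
  ... | yes _ = zero
  ... | no _  = suc x

  private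
    b↦new-b : b↦new b ≡ zero
    b↦new-b with b ≟ b
    ... | yes _  = refl
    ... | no b≢b = contradiction refl b≢b

    b↦new-other : ∀ {x} → x ≢ b → b↦new x ≡ suc x
    b↦new-other {x} x≢b with x ≟ b
    ... | yes x≡b = contradiction x≡b x≢b
    ... | no _    = refl

  endpoint-IsoOn : IsoOn H (adj H a) E (adj E (suc a)) b↦new
  endpoint-IsoOn = record
    { bijOn     = record { injective = λ {x} {y} _ _ → inj x y ; maps = λ {x} → mp x ; onto = on }
    ; preserves = λ {x} {y} → pres x y
    }
    where
    inj : ∀ x y → b↦new x ≡ b↦new y → x ≡ y
    inj x y e with x ≟ b | y ≟ b
    inj x y e  | yes refl | yes refl = refl
    inj x y () | yes _    | no _
    inj x y () | no _     | yes _
    inj x y e  | no _     | no _     = suc-injective e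
    mp : ∀ x → adj H a x ≡ true → adj E (suc a) (b↦new x) ≡ true
    mp x ax with x ≟ b
    ... | yes refl rewrite ==-refl a = refl
    ... | no x≢b   = trans (adjᴱ-old (x≢b ∘ proj₂) (a≢b ∘ proj₁)) ax
    on : ∀ {z} → adj E (suc a) z ≡ true → Σ[ x ∈ Fin (n H) ] adj H a x ≡ true × b↦new x ≡ z
    on {zero}  _  = b , ab , b↦new-b
    on {suc x} ax = x , trans (sym (adjᴱ-old (x≢b ∘ proj₂) (a≢b ∘ proj₁))) ax , b↦new-other x≢b
      where
      x≢b : x ≢ b
      x≢b refl = contradiction (trans (sym ax) adjᴱ-removed) λ ()
    new-b : ∀ {y} → adj H a y ≡ true → y ≢ b → adj E zero (suc y) ≡ adj H b y
    new-b {y} ay y≢b rewrite adjᴱ-new (adj⇒≢ H ay ∘ sym) y≢b | ay = refl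
    pres : ∀ x y → adj H a x ≡ true → adj H a y ≡ true → adj E (b↦new x) (b↦new y) ≡ adj H x y
    pres x y ax ay with x ≟ b | y ≟ b
    ... | yes refl | yes refl = sym (irrefl H b)
    ... | yes refl | no y≢b   = new-b ay y≢b
    ... | no x≢b   | yes refl = trans (new-b ax x≢b) (adj-sym H b x)
    ... | no x≢b   | no y≢b   = adjᴱ-old (y≢b ∘ proj₂) (x≢b ∘ proj₁)

  private
    b′ : Fin (n (S H a))
    b′ = proj₁ (onto (incl-IsoOn H (adj H a)) ab)

    incl-b′ : incl H (adj H a) b′ ≡ b
    incl-b′ = proj₂ (proj₂ (onto (incl-IsoOn H (adj H a)) ab))

    -- S(a) ∩ S(b), realised as a unit sphere of the (d-1)-sphere S(a) so that it is a (d-2)-sphere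
    Common : Graph
    Common = S (S H a) b′

    c : Fin (n Common) → Fin (n H)
    c = incl H (adj H a) ∘ incl (S H a) (adj (S H a) b′)

    common-IsoOn : IsoOnto Common H common c
    common-IsoOn = IsoOn-∘ (IsoOn-restrict (incl-IsoOn H (adj H a)) (λ _ → refl) (∧-conicalˡ _ _) common≡)
                           (incl-IsoOn (S H a) (adj (S H a) b′))
      where
      common≡ : ∀ {x} → true ≡ true → common (incl H (adj H a) x) ≡ adj (S H a) b′ x
      common≡ {x} _ rewrite maps (incl-IsoOn H (adj H a)) {x} refl =
        cong (λ u → adj H u (incl H (adj H a) x)) (sym incl-b′)

    c-adj-a : ∀ x → adj H a (c x) ≡ true
    c-adj-a x = ∧-conicalˡ _ _ (maps common-IsoOn {x} refl)

    c-adj-b : ∀ x → adj H b (c x) ≡ true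
    c-adj-b x = ∧-conicalʳ _ _ (maps common-IsoOn {x} refl)

    common-a : common a ≡ false
    common-a = cong (_∧ adj H b a) (irrefl H a)

    common-b : common b ≡ false
    common-b = trans (cong (adj H a b ∧_) (irrefl H b)) (∧-zeroʳ _)

    oldCommon : Fin (suc (n H)) → Bool
    oldCommon zero    = false
    oldCommon (suc x) = common x

    oldCommon-IsoOn : IsoOnto Common E oldCommon (suc ∘ c)
    oldCommon-IsoOn = IsoOn-∘ (suc-IsoOnᴱ oldCommon refl (λ _ → refl) avoids-a) common-IsoOn
      where
      avoids-a : ∀ {x y} → common x ≡ true → common y ≡ true → ¬ (x ≡ a × y ≡ b)
      avoids-a ca _ (refl , _) = contradiction (trans (sym ca) common-a) λ ()

    oldCommon+a : Fin (suc (n H)) → Bool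
    oldCommon+a y = (y == suc a) ∨ oldCommon y

    cone-IsoOn : IsoOnto (Cone Common) E oldCommon+a (suc a ∷ᶠ (suc ∘ c))
    cone-IsoOn = Attach-IsoOn-apex (const true) oldCommon+a oldCommon-IsoOn (suc a) common-a
      (λ x → trans (adjᴱ-old (adj⇒≢ H (c-adj-b x) ∘ sym ∘ proj₂) (a≢b ∘ proj₁)) (c-adj-a x))
      (cong (_∨ common a) (==-refl a))
      (λ {y} y≢sa → cong (_∨ oldCommon y) (≢⇒==false y≢sa))

    Susp-Common≅S-new : Susp Common ≅ S E zero
    Susp-Common≅S-new = IsoOnto⇒≅induced
      (Attach-IsoOn-apex nonApex (adj E zero) cone-IsoOn (suc b) sb-outside adj-sb new-sb new≗)
      where
      sb-outside : oldCommon+a (suc b) ≡ false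
      sb-outside rewrite ≢⇒==false (a≢b ∘ sym) = common-b
      adj-sb : ∀ x → adj E (suc b) ((suc a ∷ᶠ (suc ∘ c)) x) ≡ nonApex x
      adj-sb zero    = trans (adj-sym E (suc b) (suc a)) adjᴱ-removed
      adj-sb (suc x) =
        trans (adjᴱ-old (a≢b ∘ sym ∘ proj₁) (adj⇒≢ H (c-adj-a x) ∘ sym ∘ proj₂)) (c-adj-b x)
      new-sb : adj E zero (suc b) ≡ true
      new-sb rewrite ==-refl b = ∨-zeroʳ (b == a)
      new≗ : ∀ {y} → y ≢ suc b → adj E zero y ≡ oldCommon+a y
      new≗ {zero}  _     = refl
      new≗ {suc x} x≢b rewrite ≢⇒==false (x≢b ∘ cong suc) = refl

  private
    incl─a : Fin (n (H ─ a)) → Fin (n H)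
    incl─a = incl H (λ x → not (x == a))

    incl─a≢a : ∀ x → incl─a x ≢ a
    incl─a≢a x = not==⇒≢ (maps (incl-IsoOn H (λ x → not (x == a))) {x} refl)

    newNbr : Fin (n (H ─ a)) → Bool
    newNbr x = adj E zero (suc (incl─a x))

    Attach≅E─a : Attach (H ─ a) newNbr ≅ E ─ suc a
    Attach≅E─a = IsoOnto⇒≅induced ι
      where
      pres : ∀ x y → adj E (lift 1 incl─a x) (lift 1 incl─a y) ≡ adj (Attach (H ─ a) newNbr) x y
      pres zero    zero    = refl
      pres zero    (suc y) = refl
      pres (suc x) zero    = refl
      pres (suc x) (suc y) = adjᴱ-old (incl─a≢a x ∘ proj₁) (incl─a≢a y ∘ proj₂)
      ι : IsoOnto (Attach (H ─ a) newNbr) E (λ y → not (y == suc a)) (lift 1 incl─a)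
      ι = record
        { bijOn     = BijOn-lift (bijOn (incl-IsoOn H (λ x → not (x == a)))) refl (λ _ → refl)
        ; preserves = λ {x} {y} _ _ → pres x y
        }

    b+common : Fin (n H) → Bool
    b+common y = (y == b) ∨ common y

    Cone-Common≅newNbr : Cone Common ≅ induced (H ─ a) newNbr
    Cone-Common≅newNbr = sameImage⇒≅
      (Attach-IsoOn-apex (const true) b+common common-IsoOn b common-b c-adj-b
        (cong (_∨ common b) (==-refl b)) (λ {y} y≢b → cong (_∨ common y) (≢⇒==false y≢b)))
      (IsoOn-∘ (IsoOn-restrict (incl-IsoOn H (λ x → not (x == a))) (λ _ → refl) b+common⇒≢a newNbr-eq)
               (incl-IsoOn (H ─ a) newNbr))
      where
      b+common⇒≢a : ∀ {y} → b+common y ≡ true → not (y == a) ≡ true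
      b+common⇒≢a {y} by with y ≟ a
      ... | yes refl = contradiction (trans (sym by) (cong₂ _∨_ (≢⇒==false a≢b) common-a)) λ ()
      ... | no _     = refl
      newNbr-eq : ∀ {x} → true ≡ true → b+common (incl─a x) ≡ newNbr x
      newNbr-eq {x} _ rewrite ≢⇒==false (incl─a≢a x) = refl

  deletion-a : Contractible (H ─ a) → Contractible (E ─ suc a)
  deletion-a c = Contractible-resp-≅ Attach≅E─a
    (Attach-contractible c (Contractible-resp-≅ Cone-Common≅newNbr (Cone-contractible Common)))

  newVertex-sphere : ∀ d → Manifold d H → Sphere d (S E zero)
  newVertex-sphere zero    m = contradiction (subst Fin (m a) b′) λ ()
  newVertex-sphere (suc d) m =
    Sphere-resp-≅ (suc d) Susp-Common≅S-new (Susp-sphere d Common (proj₁ (m a) b′))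

∨∨∧-swap : ∀ p q r s → (p ∨ q ∨ (r ∧ s)) ≡ (q ∨ p ∨ (s ∧ r))
∨∨∧-swap true  true  _ _ = refl
∨∨∧-swap true  false _ _ = refl
∨∨∧-swap false true  _ _ = refl
∨∨∧-swap false false r s = ∧-comm r s

edgeRefinement-swap : ∀ H a b → edgeRefinement H b a ≅ edgeRefinement H a b
edgeRefinement-swap H a b = id , record
  { bijOn     = record { injective = λ _ _ e → e ; maps = λ _ → refl ; onto = λ {y} _ → y , refl , refl }
  ; preserves = λ {x} {y} _ _ → pres x y
  }
  where
  pres : ∀ x y → adj (edgeRefinement H a b) x y ≡ adj (edgeRefinement H b a) x y
  pres zero    zero    = refl
  pres zero    (suc y) = ∨∨∧-swap (y == a) (y == b) (adj H a y) (adj H b y)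
  pres (suc x) zero    = ∨∨∧-swap (x == a) (x == b) (adj H a x) (adj H b x)
  pres (suc x) (suc y) = cong (λ t → adj H x y ∧ not t) (∨-comm (x == a ∧ y == b) (x == b ∧ y == a))

module _ (H : Graph) {a b : Fin (n H)} (ab : adj H a b ≡ true) where

  private
    E : Graph
    E = edgeRefinement H a b

    ba : adj H b a ≡ true
    ba = trans (adj-sym H b a) ab

  open EdgeRefinement H ab

  endpoint? : ∀ y → y ≡ a ⊎ y ≡ b ⊎ (y ≢ a × y ≢ b)
  endpoint? y with y ≟ a | y ≟ b
  ... | yes y≡a | _       = inj₁ y≡a
  ... | no _    | yes y≡b = inj₂ (inj₁ y≡b)
  ... | no y≢a  | no y≢b  = inj₂ (inj₂ (y≢a , y≢b))

  unitSphere-refinement : ∀ y → S H y ≅ S E (suc y) ⊎ IsEdgeRefinementOf (S E (suc y)) (S H y)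
  unitSphere-refinement y with endpoint? y
  ... | inj₁ refl        = inj₁ (IsoOn⇒induced≅ endpoint-IsoOn)
  ... | inj₂ (inj₁ refl) = inj₁ (IsoOn⇒induced≅
    (IsoOn-∘ (IsoOn-S (proj₂ (edgeRefinement-swap H a b)) (suc b)) (EdgeRefinement.endpoint-IsoOn H ba)))
  ... | inj₂ (inj₂ (y≢a , y≢b)) with common y Bool.≟ true
  ...   | yes common-y = inj₂ (induced-refinement H (adj H y) (adj E (suc y)) ab
                           (trans (adj-sym H y a) (∧-conicalˡ _ _ common-y))
                           (trans (adj-sym H y b) (∧-conicalʳ _ _ common-y))
                           (trans (adjᴱ-new y≢a y≢b) common-y)
                           (λ _ → adjᴱ-old (y≢a ∘ proj₁) (y≢b ∘ proj₁)))
  ...   | no ¬common-y = inj₁ (IsoOn⇒induced≅ (away-IsoOn y≢a y≢b (¬-not ¬common-y)))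

  deletion-refinement : ∀ {w} → w ≢ a → w ≢ b → IsEdgeRefinementOf (E ─ suc w) (H ─ w)
  deletion-refinement {w} w≢a w≢b = induced-refinement H (λ x → not (x == w)) (λ y → not (y == suc w)) ab
    (cong not (≢⇒==false (w≢a ∘ sym))) (cong not (≢⇒==false (w≢b ∘ sym))) refl (λ _ → refl)

  deletion-b : Contractible (H ─ b) → Contractible (E ─ suc b)
  deletion-b c =
    Contractible-resp-≅ (─-≅ (edgeRefinement-swap H a b) (suc b)) (EdgeRefinement.deletion-a H ba c)

open IsEdgeRefinementOf

mutual
  edgeRefinement-contractible : ∀ H {a b} → adj H a b ≡ true
                              → Contractible H → Contractible (edgeRefinement H a b)
  edgeRefinement-contractible H {a} {b} ab (K₁ _ one) = contradiction (Fin1-unique one a b) (adj⇒≢ H ab)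
  edgeRefinement-contractible H ab (step _ w cS c─) =
    step _ (suc w) (unitSphere-contractible H ab w cS) (deletion-contractible H ab w c─)

  unitSphere-contractible : ∀ H {a b} (ab : adj H a b ≡ true) w
                          → Contractible (S H w) → Contractible (S (edgeRefinement H a b) (suc w))
  unitSphere-contractible H ab w c with unitSphere-refinement H ab w
  ... | inj₁ σ = Contractible-resp-≅ σ c
  ... | inj₂ ρ = Contractible-resp-≅ (iso ρ) (edgeRefinement-contractible _ (edge ρ) c)

  deletion-contractible : ∀ H {a b} (ab : adj H a b ≡ true) w
                        → Contractible (H ─ w) → Contractible (edgeRefinement H a b ─ suc w)
  deletion-contractible H ab w c with endpoint? H ab w
  ... | inj₁ refl               = EdgeRefinement.deletion-a H ab c
  ... | inj₂ (inj₁ refl)        = deletion-b H ab c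
  ... | inj₂ (inj₂ (w≢a , w≢b)) = let ρ = deletion-refinement H ab w≢a w≢b
                                  in Contractible-resp-≅ (iso ρ) (edgeRefinement-contractible _ (edge ρ) c)

mutual
  edgeRefinement-sphere : ∀ k H {a b} → adj H a b ≡ true → Sphere k H → Sphere k (edgeRefinement H a b)
  edgeRefinement-sphere zero    H {a} _  empty       = contradiction (subst Fin empty a) λ ()
  edgeRefinement-sphere (suc k) H ab  (m , w , c) =
    edgeRefinement-manifold k H ab m , suc w , deletion-contractible H ab w c

  edgeRefinement-manifold : ∀ d H {a b} → adj H a b ≡ true
                          → Manifold d H → Manifold d (edgeRefinement H a b)
  edgeRefinement-manifold d H ab m zero    = EdgeRefinement.newVertex-sphere H ab d m
  edgeRefinement-manifold d H ab m (suc y) with unitSphere-refinement H ab y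
  ... | inj₁ σ = Sphere-resp-≅ d σ (m y)
  ... | inj₂ ρ = Sphere-resp-≅ d (iso ρ) (edgeRefinement-sphere d _ (edge ρ) (m y))

mainTheorem13 : (d : ℕ) (G : Graph) → Manifold d G
                → (a b : Fin (n G)) → adj G a b ≡ true
                → Manifold d (edgeRefinement G a b)
mainTheorem13 d G m a b ab = edgeRefinement-manifold d G ab m
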